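{- Let $\tilde T$ be a bridging triangulation of the annulus $C_{p,q}$ and let $\underline{i}=i_1,\ldots,i_n$ be an admissible ordering of the vertices of the associated quiver $Q_{\tilde T}$. Then the Coxeter transformation $\mathrm{cox}_{\underline{i}}(\tilde T)=\mu_{d_{i_n}}\cdots\mu_{d_{i_1}}\tilde T$ moves the endpoints of all arcs by $-1$ on both $\partial$ and $\partial'$; that is, in the universal cover every arc $[j_\partial,k_{\partial'}]$ of $\tilde T$ is sent to $[(j-1)_\partial,(k-1)_{\partial'}]$.
   Context: $C_{p,q}$ is an annulus with $p>0$ marked points on the outer boundary $\partial$ and $q>0$ on the inner boundary $\partial'$ ($p\ge q$), oriented counter-clockwise. Arcs are taken up to isotopy (curves between marked points, not self-intersecting in the interior, interior disjoint from the boundary, not cutting out an unpunctured monogon or digon); a triangulation is a maximal collection of pairwise non-crossing arcs. An arc is peripheral if both endpoints lie on the same boundary component and bridging otherwise; a bridging triangulation is one consisting only of bridging arcs. Labelling in the universal cover $\mathbb U=\mathbb R\times[0,1]$ with covering map $(x,y)\mapsto(x \bmod pq,y)$: the marked points are $i_\partial=(iq,0)$ and $j_{\partial'}=(-jp,1)$ for $i,j\in\mathbb Z$; $[a,b]$ denotes the arc with endpoints $a,b$. The quiver $Q_T$ of a triangulation $T$ with arcs $d_1,\dots,d_n$ has vertices $1,\dots,n$ and an arrow $i\to j$ whenever $d_i,d_j$ bound a common triangle and $d_j$ is a clockwise rotation of $d_i$ about their common endpoint. A flip $\mu_{d}$ replaces the arc $d$, a diagonal of a quadrilateral of the triangulation,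 by the other diagonal. For a source $i$ of a quiver $Q$, $\sigma_iQ$ is obtained by reversing all arrows incident to $i$. An ordering $i_1,\ldots,i_n$ of the vertices of $Q$ is admissible if for each $p$ the vertex $i_p$ is a source of $\sigma_{i_{p-1}}\cdots\sigma_{i_1}Q$. -}

module Defs where

open import Data.Nat using (ℕ)
open import Data.Integer using (ℤ; +_; _+_; _-_; _*_; _<_; _≤_; 1ℤ)
open import Data.Fin using (Fin; _≟_)
open import Data.Bool using (Bool; true; false; if_then_else_; _∨_)
open import Data.List using (List; []; _∷_)
open import Data.Product using (_×_; _,_; Σ; ∃; ∃-syntax)
open import Data.Sum using (_⊎_)
open import Data.Unit using (⊤)
open import Data.Empty using (⊥)
open import Relation.Nullary using (¬_)
open import Relation.Nullary.Decidable using (⌊_⌋)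
open import Relation.Binary.PropositionalEquality using (_≡_; _≢_)

-- Marked points in the universal cover U = ℝ × [0,1] of C_{p,q}.
--   out i  is  i_∂  = (i q , 0)   (outer boundary ∂)
--   inn j  is  j_∂' = (-j p , 1)  (inner boundary ∂')
-- The boundary of the strip U, traversed counter-clockwise (interior on
-- the left), visits the bottom line left-to-right (i increasing) and then
-- the top line right-to-left (x = -jp decreasing, i.e. j increasing).
-- Cutting this circle at the point at -∞ gives the linear order _≺_:
-- all outer points (by i) precede all inner points (by j).

data Pt : Set where
  out : ℤ → Pt
  inn : ℤ → Pt

data _≺_ : Pt → Pt → Set where
  oo : ∀ {i i'} → i < i' → out i ≺ out i'
  oi : ∀ {i j} → out i ≺ inn j
  ii : ∀ {j j'} → j < j' → inn j ≺ inn j'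

-- A lift of an arc to U (a curve in U with two marked endpoints; up to
-- isotopy in U it is determined by its unordered pair of endpoints).
Chord : Set
Chord = Pt × Pt

UEq : Chord → Chord → Set
UEq (a , b) (c , d) = (a ≡ c × b ≡ d) ⊎ (a ≡ d × b ≡ c)

module Annulus (p q : ℕ) where

  -- deck transformation x ↦ x + k·pq :  i_∂ ↦ (i+kp)_∂ ,  j_∂' ↦ (j-kq)_∂'
  τPt : ℤ → Pt → Pt
  τPt k (out i) = out (i + k * + p)
  τPt k (inn j) = inn (j - k * + q)

  τ : ℤ → Chord → Chord
  τ k (a , b) = τPt k a , τPt k b

  -- Lifts of arcs of C_{p,q}, with the first endpoint the ≺-smaller one:
  --  * bridging:            [i_∂ , j_∂']
  --  * peripheral on ∂ :    [a_∂ , b_∂]   with 2 ≤ b - a ≤ p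
  --  * peripheral on ∂':    [a_∂', b_∂']  with 2 ≤ b - a ≤ q
  -- (b - a = 1 would be a boundary segment, i.e. cut out a digon/monogon;
  --  b - a larger than p resp. q would self-intersect in the annulus).
  ValidOrd : Chord → Set
  ValidOrd (out i , inn j) = ⊤
  ValidOrd (out a , out b) = (+ 2 ≤ b - a) × (b - a ≤ + p)
  ValidOrd (inn a , inn b) = (+ 2 ≤ b - a) × (b - a ≤ + q)
  ValidOrd (inn j , out i) = ⊥

  Valid : Chord → Set
  Valid (a , b) = ValidOrd (a , b) ⊎ ValidOrd (b , a)

  IsBridging : Chord → Set
  IsBridging (out i , inn j) = ⊤
  IsBridging (inn j , out i) = ⊤
  IsBridging (out _ , out _) = ⊥
  IsBridging (inn _ , inn _) = ⊥

  -- two chords in U (a disc) cross in their interiors iff their endpoints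
  -- strictly interleave along the boundary
  Between : Pt → Pt → Pt → Set
  Between a x b = (a ≺ x × x ≺ b) ⊎ (b ≺ x × x ≺ a)

  Outside : Pt → Pt → Pt → Set
  Outside a x b = (x ≺ a × x ≺ b) ⊎ (a ≺ x × b ≺ x)

  CrossU : Chord → Chord → Set
  CrossU (a , b) (c , d) =
    (Between a c b × Outside a d b) ⊎ (Outside a c b × Between a d b)

  -- arcs of the annulus (given by lifts) cross iff some lifts cross
  Cross : Chord → Chord → Set
  Cross c c' = ∃[ k ] CrossU c (τ k c')

  SameArc : Chord → Chord → Set
  SameArc c c' = ∃[ k ] UEq c (τ k c')

  record IsTriangulation {n : ℕ} (d : Fin n → Chord) : Set where
    field
      valid    : ∀ a → Valid (d a)
      distinct : ∀ a b → a ≢ b → ¬ SameArc (d a) (d b)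
      noCross  : ∀ a b → ¬ Cross (d a) (d b)
      maximal  : ∀ c → Valid c → (∀ a → ¬ Cross c (d a)) →
                 ∃[ a ] SameArc c (d a)

  IsBridgingTriangulation : {n : ℕ} → (Fin n → Chord) → Set
  IsBridgingTriangulation {n} d = IsTriangulation d × (∀ a → IsBridging (d a))

  -- boundary segments (sides of triangles that are not arcs), lifted to U
  BSeg : Pt → Pt → Set
  BSeg (out a) (out b) = (b ≡ a + 1ℤ) ⊎ (a ≡ b + 1ℤ)
  BSeg (inn a) (inn b) = (b ≡ a + 1ℤ) ⊎ (a ≡ b + 1ℤ)
  BSeg _ _ = ⊥

  Joined : {n : ℕ} → (Fin n → Chord) → Pt → Pt → Set
  Joined d u w = (∃[ a ] ∃[ k ] UEq (u , w) (τ k (d a))) ⊎ BSeg u w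

  CCW : Pt → Pt → Pt → Set
  CCW v y x = (v ≺ y × y ≺ x) ⊎ (y ≺ x × x ≺ v) ⊎ (x ≺ v × v ≺ y)

  -- The quiver Q_T (as its arrow relation): an arrow a → b iff d_a and d_b
  -- bound a common triangle (v , x , y) of T (lifted to U), with d_a = [v,x],
  -- d_b = [v,y], and d_b is a clockwise rotation of d_a about v
  -- (equivalently, seen from v, y comes before x counter-clockwise).
  Quiver : {n : ℕ} → (Fin n → Chord) → Fin n → Fin n → Set
  Quiver d a b =
    ∃[ v ] ∃[ x ] ∃[ y ] ∃[ k ] ∃[ k' ]
      UEq (v , x) (τ k (d a)) × UEq (v , y) (τ k' (d b)) ×
      Joined d x y × CCW v y x

  -- All other arcs unchanged; d_a = [u,w] (a lift)
  -- is the diagonal of the quadrilateral formed by the two triangles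
  -- (u,w,x), (u,w,y) of T, and is replaced by the other diagonal [x,y].
  IsFlip : {n : ℕ} → (Fin n → Chord) → Fin n → (Fin n → Chord) → Set
  IsFlip d a d' =
    (∀ b → b ≢ a → SameArc (d' b) (d b)) ×
    (∃[ u ] ∃[ w ] ∃[ x ] ∃[ y ] ∃[ k ]
      UEq (u , w) (τ k (d a)) × x ≢ y ×
      Joined d u x × Joined d w x × Joined d u y × Joined d w y ×
      SameArc (d' a) (x , y))

  data CoxChain {n : ℕ} : (Fin n → Chord) → List (Fin n) → (Fin n → Chord) → Set where
    done : ∀ {d} → CoxChain d [] d
    step : ∀ {d d₁ d₂ i is} → IsFlip d i d₁ → CoxChain d₁ is d₂ →
           CoxChain d (i ∷ is) d₂

shiftPt : Pt → Pt
shiftPt (out i) = out (i - 1ℤ)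
shiftPt (inn j) = inn (j - 1ℤ)

shift : Chord → Chord
shift (a , b) = shiftPt a , shiftPt b

Quiv : ℕ → Set₁
Quiv n = Fin n → Fin n → Set

IsSource : {n : ℕ} → Quiv n → Fin n → Set
IsSource Q i = ∀ j → ¬ Q j i

σ : {n : ℕ} → Fin n → Quiv n → Quiv n
σ i Q a b = if (⌊ a ≟ i ⌋ ∨ ⌊ b ≟ i ⌋) then Q b a else Q a b

AdmissibleSeq : {n : ℕ} → Quiv n → List (Fin n) → Set
AdmissibleSeq Q [] = ⊤
AdmissibleSeq Q (i ∷ is) = IsSource Q i × AdmissibleSeq (σ i Q) is

-- Work in the universal cover, where a bridging arc lifts to chords [i_∂ , j_∂'].  Two such chords
-- [i , j] and [i' , j'] cross exactly when i < i' and j < j' (or the reverse), so among the lifts of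
-- the arcs of a bridging triangulation T the slope i - j determines the lift, and the arcs of T form a
-- chain: after [I , J] comes [I+1 , J] or [I , J-1], before it [I-1 , J] or [I , J+1], and the arrow
-- of Q_T between neighbours points one way or the other according to the case.  Flipping along an
-- admissible order maintains two invariants: flipped arcs are moved by -1 on both boundaries while the
-- others stay put, and the current quiver is Q_T with the arrows between flipped and unflipped arcs
-- reversed.  When d_i is a source, these force its two neighbours to sit at [I-1 , J] and [I , J-1],
-- so the quadrilateral around d_i has its other corners at (I-1)_∂ and (J-1)_∂' and the flip produces
-- [I-1 , J-1].

module Submission where

open import Defs
open import Data.Bool using (Bool; true; false; not; _xor_)
open import Data.Bool.Properties using (xor-same; xor-comm; not-distribˡ-xor; not-distribʳ-xor)
open import Data.Empty using (⊥; ⊥-elim)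
open import Data.Fin using (Fin)
import Data.Fin as Fin
import Data.Fin.Properties as Fin
open import Data.Integer using (ℤ; +_; 0ℤ; 1ℤ; -_; _+_; _-_; _*_)
import Data.Integer as ℤ
import Data.Integer.Properties as ℤ
open import Algebra.Properties.AbelianGroup ℤ.+-0-abelianGroup using (∙-cancelˡ; ∙-cancelʳ)
open import Data.Integer.Divisibility.Signed using (_∣?_; divides)
open import Data.Integer.Tactic.RingSolver using (solve-∀)
open import Data.List using (List; []; _∷_; allFin)
open import Data.List.Membership.Propositional using (_∉_)
open import Data.List.Membership.Propositional.Properties using (∈-allFin)
open import Data.List.Relation.Binary.Permutation.Propositional using (_↭_; ↭-sym; ↭⇒↭ₛ)
open import Data.List.Relation.Binary.Permutation.Propositional.Properties using (∈-resp-↭)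
open import Data.List.Relation.Unary.All.Properties using (All¬⇒¬Any)
open import Data.List.Relation.Unary.AllPairs using (_∷_)
open import Data.List.Relation.Unary.Any using (here)
open import Data.List.Relation.Unary.Unique.Propositional using (Unique)
open import Data.List.Relation.Unary.Unique.Propositional.Properties using (allFin⁺)
open import Data.Nat using (ℕ; NonZero; >-nonZero)
open import Data.Product using (_×_; _,_; proj₁; proj₂; ∃-syntax)
open import Data.Sum using (_⊎_; inj₁; inj₂)
open import Data.Unit using (tt)
open import Relation.Binary.Core using (_⇒_)
open import Relation.Binary.Definitions using (tri<; tri≈; tri>)
open import Relation.Binary.PropositionalEquality
  using (_≡_; _≢_; refl; sym; trans; cong; cong₂; subst; subst₂; setoid; module ≡-Reasoning)
open import Relation.Nullary using (¬_; Dec; yes; no; does)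
open import Relation.Nullary.Decidable using (map′; dec-true; dec-false)

i-1+1≡i : ∀ i → i - 1ℤ + 1ℤ ≡ i
i-1+1≡i = solve-∀

i+1-1≡i : ∀ i → i + 1ℤ - 1ℤ ≡ i
i+1-1≡i = solve-∀

x+[i-x]≡i : ∀ i x → x + (i - x) ≡ i
x+[i-x]≡i = solve-∀

x+z-x≡z : ∀ x z → x + z - x ≡ z
x+z-x≡z = solve-∀

bridge : ℤ → ℤ → Chord
bridge i j = out i , inn j

mapChord : (Pt → Pt) → Chord → Chord
mapChord f (a , b) = f a , f b

UEq-refl : ∀ c → UEq c c
UEq-refl _ = inj₁ (refl , refl)

UEq-sym : ∀ {c c'} → UEq c c' → UEq c' c
UEq-sym {_ , _} {_ , _} (inj₁ (refl , refl)) = inj₁ (refl , refl)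
UEq-sym {_ , _} {_ , _} (inj₂ (refl , refl)) = inj₂ (refl , refl)

UEq-trans : ∀ {c c' c''} → UEq c c' → UEq c' c'' → UEq c c''
UEq-trans {_ , _} {_ , _} {_ , _} (inj₁ (refl , refl)) e = e
UEq-trans {_ , _} {_ , _} {_ , _} (inj₂ (refl , refl)) (inj₁ (refl , refl)) = inj₂ (refl , refl)
UEq-trans {_ , _} {_ , _} {_ , _} (inj₂ (refl , refl)) (inj₂ (refl , refl)) = inj₁ (refl , refl)

UEq-swapˡ : ∀ {a b c} → UEq (a , b) c → UEq (b , a) c
UEq-swapˡ {c = _ , _} (inj₁ (refl , refl)) = inj₂ (refl , refl)
UEq-swapˡ {c = _ , _} (inj₂ (refl , refl)) = inj₁ (refl , refl)

UEq-map : ∀ f {c c'} → UEq c c' → UEq (mapChord f c) (mapChord f c')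
UEq-map f {_ , _} {_ , _} (inj₁ (refl , refl)) = inj₁ (refl , refl)
UEq-map f {_ , _} {_ , _} (inj₂ (refl , refl)) = inj₂ (refl , refl)

UEq-unmap : ∀ {f} → (∀ {x y} → f x ≡ f y → x ≡ y) →
            ∀ {c c'} → UEq (mapChord f c) (mapChord f c') → UEq c c'
UEq-unmap f-inj {_ , _} {_ , _} (inj₁ (e , e')) = inj₁ (f-inj e , f-inj e')
UEq-unmap f-inj {_ , _} {_ , _} (inj₂ (e , e')) = inj₂ (f-inj e , f-inj e')

position : Pt → ℤ
position (out i) = i
position (inn j) = j

shiftPt-injective : ∀ {x y} → shiftPt x ≡ shiftPt y → x ≡ y
shiftPt-injective {out a} {out b} e = cong out (∙-cancelʳ (- 1ℤ) a b (cong position e))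
shiftPt-injective {inn a} {inn b} e = cong inn (∙-cancelʳ (- 1ℤ) a b (cong position e))
shiftPt-injective {out _} {inn _} ()
shiftPt-injective {inn _} {out _} ()

module LatticeChords where

  open import Data.Integer using (_<_)

  i<i+1 : ∀ i → i < i + 1ℤ
  i<i+1 i = ℤ.suc[i]≤j⇒i<j (ℤ.≤-reflexive (ℤ.+-comm 1ℤ i))

  i-1<i : ∀ i → i - 1ℤ < i
  i-1<i i = subst (i - 1ℤ <_) (i-1+1≡i i) (i<i+1 (i - 1ℤ))

  ¬i<j<i+1 : ∀ {i j} → i < j → j < i + 1ℤ → ⊥
  ¬i<j<i+1 {i} i<j j<i+1 =
    ℤ.<⇒≱ j<i+1 (subst (ℤ._≤ _) (ℤ.+-comm 1ℤ i) (ℤ.i<j⇒suc[i]≤j i<j))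

  ¬i-1<j<i : ∀ {i j} → i - 1ℤ < j → j < i → ⊥
  ¬i-1<j<i {i} i-1<j j<i = ¬i<j<i+1 i-1<j (subst (_ <_) (sym (i-1+1≡i i)) j<i)

  <-from-equal-differences : ∀ {i j i' j'} → i - j ≡ i' - j' → i < i' → j < j'
  <-from-equal-differences {i} {j} {i'} {j'} e i<i' =
    subst₂ _<_ (cancel i j) (trans (cong (λ z → i' + - z) e) (cancel i' j'))
      (ℤ.+-monoˡ-< (- (i - j)) i<i')
    where
    cancel : ∀ i j → i + - (i - j) ≡ j
    cancel = solve-∀

  Crossing : ℤ → ℤ → ℤ → ℤ → Set
  Crossing i j i' j' = (i < i' × j < j') ⊎ (i' < i × j' < j)

  Crossing-neg : ∀ {i j i' j'} → Crossing (- i) (- j) i' j' → Crossing i j (- i') (- j')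
  Crossing-neg (inj₁ (-i<i' , -j<j')) = inj₂ (neg-flip -i<i' , neg-flip -j<j')
    where
    neg-flip : ∀ {x y} → - x < y → - y < x
    neg-flip {x} -x<y = subst (_ <_) (ℤ.neg-involutive x) (ℤ.neg-mono-< -x<y)
  Crossing-neg (inj₂ (i'<-i , j'<-j)) = inj₁ (neg-flip i'<-i , neg-flip j'<-j)
    where
    neg-flip : ∀ {x y} → y < - x → x < - y
    neg-flip {x} y<-x = subst (_< _) (ℤ.neg-involutive x) (ℤ.neg-mono-< y<-x)

  record MaximalNonCrossing : Set₁ where
    field
      Has         : ℤ → ℤ → Set
      has?        : ∀ i j → Dec (Has i j)
      nonCrossing : ∀ {i j i' j'} → Has i j → Has i' j' → i < i' → j < j' → ⊥
      maximal     : ∀ {i j} → (∀ {i' j'} → Has i' j' → ¬ Crossing i j i' j') → Has i j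

  -- the half-turn (i , j) ↦ (-i , -j) of the strip, which reverses the chain of arcs
  mirror : MaximalNonCrossing → MaximalNonCrossing
  mirror S = record
    { Has         = λ i j → Has (- i) (- j)
    ; has?        = λ i j → has? (- i) (- j)
    ; nonCrossing = λ h h' i<i' j<j' → nonCrossing h' h (ℤ.neg-mono-< i<i') (ℤ.neg-mono-< j<j')
    ; maximal     = λ free → maximal λ {i'} {j'} h' c →
        free (subst₂ Has (sym (ℤ.neg-involutive i')) (sym (ℤ.neg-involutive j')) h') (Crossing-neg c)
    }
    where open MaximalNonCrossing S

  module _ (S : MaximalNonCrossing) where
    open MaximalNonCrossing S

    fill-below : ∀ {i j j'} → Has i j → Has i j' → j' < j - 1ℤ → Has i (j - 1ℤ)
    fill-below {i} {j} {j'} h h' j'<j-1 = maximal free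
      where
      free : ∀ {i'' j''} → Has i'' j'' → ¬ Crossing i (j - 1ℤ) i'' j''
      free h'' (inj₂ (i''<i , j''<j-1)) = nonCrossing h'' h i''<i (ℤ.<-trans j''<j-1 (i-1<i j))
      free {j'' = j''} h'' (inj₁ (i<i'' , j-1<j'')) with ℤ.<-cmp j'' j
      ... | tri< j''<j _ _ = ¬i-1<j<i j-1<j'' j''<j
      ... | tri≈ _ refl _ = nonCrossing h' h'' i<i'' (ℤ.<-trans j'<j-1 (i-1<i j))
      ... | tri> _ _ j<j'' = nonCrossing h h'' i<i'' j<j''

    next : ∀ {i j} → Has i j → Has (i + 1ℤ) j ⊎ Has i (j - 1ℤ)
    next {i} {j} h with has? i (j - 1ℤ)
    ... | yes h₁ = inj₂ h₁
    ... | no ¬h₁ = inj₁ (maximal free)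
      where
      free : ∀ {i' j'} → Has i' j' → ¬ Crossing (i + 1ℤ) j i' j'
      free h' (inj₁ (i+1<i' , j<j')) = nonCrossing h h' (ℤ.<-trans (i<i+1 i) i+1<i') j<j'
      free {i'} {j'} h' (inj₂ (i'<i+1 , j'<j)) with ℤ.<-cmp i' i
      ... | tri< i'<i _ _ = nonCrossing h' h i'<i j'<j
      ... | tri> _ _ i<i' = ¬i<j<i+1 i<i' i'<i+1
      ... | tri≈ _ refl _ with ℤ.<-cmp j' (j - 1ℤ)
      ...   | tri< j'<j-1 _ _ = ¬h₁ (fill-below h h' j'<j-1)
      ...   | tri≈ _ refl _ = ¬h₁ h'
      ...   | tri> _ _ j-1<j' = ¬i-1<j<i j-1<j' j'<j

  module _ (S : MaximalNonCrossing) where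
    open MaximalNonCrossing S

    previous : ∀ {i j} → Has i j → Has (i - 1ℤ) j ⊎ Has i (j + 1ℤ)
    previous {i} {j} h
      with next (mirror S) (subst₂ Has (sym (ℤ.neg-involutive i)) (sym (ℤ.neg-involutive j)) h)
    ... | inj₁ h' = inj₁ (subst₂ Has (neg-step i) (ℤ.neg-involutive j) h')
      where
      neg-step : ∀ i → - (- i + 1ℤ) ≡ i - 1ℤ
      neg-step = solve-∀
    ... | inj₂ h' = inj₂ (subst₂ Has (ℤ.neg-involutive i) (neg-step j) h')
      where
      neg-step : ∀ j → - (- j - 1ℤ) ≡ j + 1ℤ
      neg-step = solve-∀

module Cover (p q : ℕ) {{_ : NonZero p}} where

  open Annulus p q
  open LatticeChords
  open import Data.Integer using (_<_)

  τPt-identity : ∀ x → τPt 0ℤ x ≡ x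
  τPt-identity (out i) = cong out (ℤ.+-identityʳ i)
  τPt-identity (inn j) = cong inn (ℤ.+-identityʳ j)

  τPt-homo : ∀ k l x → τPt k (τPt l x) ≡ τPt (l + k) x
  τPt-homo k l (out i) = cong out (identity i k l (+ p))
    where
    identity : ∀ i k l P → (i + l * P) + k * P ≡ i + (l + k) * P
    identity = solve-∀
  τPt-homo k l (inn j) = cong inn (identity j k l (+ q))
    where
    identity : ∀ j k l Q → (j - l * Q) - k * Q ≡ j - (l + k) * Q
    identity = solve-∀

  τ-identity : ∀ c → τ 0ℤ c ≡ c
  τ-identity (a , b) = cong₂ _,_ (τPt-identity a) (τPt-identity b)

  τ-homo : ∀ k l c → τ k (τ l c) ≡ τ (l + k) c
  τ-homo k l (a , b) = cong₂ _,_ (τPt-homo k l a) (τPt-homo k l b)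

  τ-inverse : ∀ k c → τ (- k) (τ k c) ≡ c
  τ-inverse k c = begin
    τ (- k) (τ k c)  ≡⟨ τ-homo (- k) k c ⟩
    τ (k + - k) c    ≡⟨ cong (λ l → τ l c) (ℤ.+-inverseʳ k) ⟩
    τ 0ℤ c           ≡⟨ τ-identity c ⟩
    c                ∎
    where open ≡-Reasoning

  UEq⇒SameArc : ∀ {c c'} → UEq c c' → SameArc c c'
  UEq⇒SameArc {c' = c'} e = 0ℤ , subst (UEq _) (sym (τ-identity c')) e

  SameArc-refl : ∀ c → SameArc c c
  SameArc-refl c = UEq⇒SameArc (UEq-refl c)

  SameArc-sym : ∀ {c c'} → SameArc c c' → SameArc c' c
  SameArc-sym {c} {c'} (k , e) =
    - k , UEq-sym (subst (UEq (τ (- k) c)) (τ-inverse k c') (UEq-map (τPt (- k)) e))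

  SameArc-trans : ∀ {c c' c''} → SameArc c c' → SameArc c' c'' → SameArc c c''
  SameArc-trans {c} {c'} {c''} (k , e) (l , e') =
    l + k , UEq-trans e (subst (UEq (τ k c')) (τ-homo k l c'') (UEq-map (τPt k) e'))

  SameArc-swapʳ : ∀ {c a b} → SameArc c (a , b) → SameArc c (b , a)
  SameArc-swapʳ l = SameArc-trans l (UEq⇒SameArc (inj₂ (refl , refl)))

  shiftPt-τPt : ∀ k x → shiftPt (τPt k x) ≡ τPt k (shiftPt x)
  shiftPt-τPt k (out i) = cong out (identity i k (+ p))
    where
    identity : ∀ i k P → (i + k * P) - 1ℤ ≡ (i - 1ℤ) + k * P
    identity = solve-∀
  shiftPt-τPt k (inn j) = cong inn (identity j k (+ q))
    where
    identity : ∀ j k Q → (j - k * Q) - 1ℤ ≡ (j - 1ℤ) - k * Q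
    identity = solve-∀

  shift-τ : ∀ k c → shift (τ k c) ≡ τ k (shift c)
  shift-τ k (a , b) = cong₂ _,_ (shiftPt-τPt k a) (shiftPt-τPt k b)

  SameArc-shift : ∀ {c c'} → SameArc c c' → SameArc (shift c) (shift c')
  SameArc-shift {c} {c'} (k , e) = k , subst (UEq (shift c)) (shift-τ k c') (UEq-map shiftPt e)

  SameArc-unshift : ∀ {c c'} → SameArc (shift c) (shift c') → SameArc c c'
  SameArc-unshift {c} {c'} (k , e) =
    k , UEq-unmap shiftPt-injective (subst (UEq (shift c)) (sym (shift-τ k c')) e)

  Between-sym : ∀ {a x b} → Between a x b → Between b x a
  Between-sym (inj₁ h) = inj₂ h
  Between-sym (inj₂ h) = inj₁ h

  Outside-sym : ∀ {a x b} → Outside a x b → Outside b x a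
  Outside-sym (inj₁ (h , h')) = inj₁ (h' , h)
  Outside-sym (inj₂ (h , h')) = inj₂ (h' , h)

  CrossU-swapˡ : ∀ {a b c} → CrossU (a , b) c → CrossU (b , a) c
  CrossU-swapˡ {c = _ , _} (inj₁ (h , h')) = inj₁ (Between-sym h , Outside-sym h')
  CrossU-swapˡ {c = _ , _} (inj₂ (h , h')) = inj₂ (Outside-sym h , Between-sym h')

  CrossU-swapʳ : ∀ {c a b} → CrossU c (a , b) → CrossU c (b , a)
  CrossU-swapʳ {_ , _} (inj₁ (h , h')) = inj₂ (h' , h)
  CrossU-swapʳ {_ , _} (inj₂ (h , h')) = inj₁ (h' , h)

  CrossU-respˡ-UEq : ∀ {c c' e} → UEq c c' → CrossU c e → CrossU c' e
  CrossU-respˡ-UEq {_ , _} {_ , _} (inj₁ (refl , refl)) h = h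
  CrossU-respˡ-UEq {_ , _} {_ , _} (inj₂ (refl , refl)) h = CrossU-swapˡ h

  CrossU-respʳ-UEq : ∀ {c e e'} → UEq e e' → CrossU c e → CrossU c e'
  CrossU-respʳ-UEq {_} {_ , _} {_ , _} (inj₁ (refl , refl)) h = h
  CrossU-respʳ-UEq {_} {_ , _} {_ , _} (inj₂ (refl , refl)) h = CrossU-swapʳ h

  τPt-mono-≺ : ∀ k {x y} → x ≺ y → τPt k x ≺ τPt k y
  τPt-mono-≺ k (oo i<i') = oo (ℤ.+-monoˡ-< (k * + p) i<i')
  τPt-mono-≺ k oi        = oi
  τPt-mono-≺ k (ii j<j') = ii (ℤ.+-monoˡ-< (- (k * + q)) j<j')

  Between-τ : ∀ k {a x b} → Between a x b → Between (τPt k a) (τPt k x) (τPt k b)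
  Between-τ k (inj₁ (h , h')) = inj₁ (τPt-mono-≺ k h , τPt-mono-≺ k h')
  Between-τ k (inj₂ (h , h')) = inj₂ (τPt-mono-≺ k h , τPt-mono-≺ k h')

  Outside-τ : ∀ k {a x b} → Outside a x b → Outside (τPt k a) (τPt k x) (τPt k b)
  Outside-τ k (inj₁ (h , h')) = inj₁ (τPt-mono-≺ k h , τPt-mono-≺ k h')
  Outside-τ k (inj₂ (h , h')) = inj₂ (τPt-mono-≺ k h , τPt-mono-≺ k h')

  CrossU-τ : ∀ k {c e} → CrossU c e → CrossU (τ k c) (τ k e)
  CrossU-τ k {_ , _} {_ , _} (inj₁ (h , h')) = inj₁ (Between-τ k h , Outside-τ k h')
  CrossU-τ k {_ , _} {_ , _} (inj₂ (h , h')) = inj₂ (Outside-τ k h , Between-τ k h')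

  CrossU⇒Cross : ∀ {c c' e e'} → CrossU c c' → SameArc c e → SameArc c' e' → Cross e e'
  CrossU⇒Cross {e = e} {e'} cr (k , l) (k' , l') =
    k' + - k , subst₂ CrossU (τ-inverse k e) (τ-homo (- k) k' e')
      (CrossU-τ (- k) (CrossU-respʳ-UEq l' (CrossU-respˡ-UEq l cr)))

  CrossU-bridge⁺ : ∀ {A B X Y} → A < X → B < Y → CrossU (bridge A B) (bridge X Y)
  CrossU-bridge⁺ A<X B<Y = inj₁ (inj₁ (oo A<X , oi) , inj₂ (oi , ii B<Y))

  CrossU-bridge⁻ : ∀ {A B X Y} → CrossU (bridge A B) (bridge X Y) → Crossing A B X Y
  CrossU-bridge⁻ (inj₁ (inj₁ (oo _ , oi) , inj₁ (() , _)))
  CrossU-bridge⁻ (inj₁ (inj₁ (oo A<X , oi) , inj₂ (oi , ii B<Y))) = inj₁ (A<X , B<Y)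
  CrossU-bridge⁻ (inj₁ (inj₂ (() , _) , _))
  CrossU-bridge⁻ (inj₂ (inj₁ (oo X<A , oi) , inj₁ (oi , ii Y<B))) = inj₂ (X<A , Y<B)
  CrossU-bridge⁻ (inj₂ (inj₁ (oo _ , oi) , inj₂ (_ , ())))
  CrossU-bridge⁻ (inj₂ (inj₂ (_ , ()) , _))

  IsBridging-resp-UEq : ∀ {c c'} → UEq c c' → IsBridging c' → IsBridging c
  IsBridging-resp-UEq {_ , _} {_ , _} (inj₁ (refl , refl)) h = h
  IsBridging-resp-UEq {_ , _} {out _ , inn _} (inj₂ (refl , refl)) _ = tt
  IsBridging-resp-UEq {_ , _} {inn _ , out _} (inj₂ (refl , refl)) _ = tt

  IsBridging-τ : ∀ k {c} → IsBridging c → IsBridging (τ k c)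
  IsBridging-τ k {out _ , inn _} _ = tt
  IsBridging-τ k {inn _ , out _} _ = tt

  IsBridging-shift : ∀ {c} → IsBridging c → IsBridging (shift c)
  IsBridging-shift {out _ , inn _} _ = tt
  IsBridging-shift {inn _ , out _} _ = tt

  IsBridging-resp-SameArc : ∀ {c c'} → SameArc c c' → IsBridging c' → IsBridging c
  IsBridging-resp-SameArc (k , e) h = IsBridging-resp-UEq e (IsBridging-τ k h)

  bridging-lift : ∀ {c} → IsBridging c → ∃[ X ] ∃[ Y ] SameArc (bridge X Y) c
  bridging-lift {out x , inn y} _ = x , y , SameArc-refl _
  bridging-lift {inn y , out x} _ = x , y , UEq⇒SameArc (inj₂ (refl , refl))

  bridging-endpoints : ∀ {c u w k} → IsBridging c → UEq (u , w) (τ k c) →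
    ∃[ X ] ∃[ Y ] SameArc (bridge X Y) c × (u ≡ out X × w ≡ inn Y ⊎ u ≡ inn Y × w ≡ out X)
  bridging-endpoints {out _ , inn _} {k = k} _ (inj₁ (refl , refl)) =
    _ , _ , (k , inj₁ (refl , refl)) , inj₁ (refl , refl)
  bridging-endpoints {out _ , inn _} {k = k} _ (inj₂ (refl , refl)) =
    _ , _ , (k , inj₁ (refl , refl)) , inj₂ (refl , refl)
  bridging-endpoints {inn _ , out _} {k = k} _ (inj₁ (refl , refl)) =
    _ , _ , (k , inj₂ (refl , refl)) , inj₂ (refl , refl)
  bridging-endpoints {inn _ , out _} {k = k} _ (inj₂ (refl , refl)) =
    _ , _ , (k , inj₂ (refl , refl)) , inj₁ (refl , refl)

  Cross-bridge⁻ : ∀ {c A B} → IsBridging c → Cross (bridge A B) c →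
    ∃[ X ] ∃[ Y ] SameArc (bridge X Y) c × Crossing A B X Y
  Cross-bridge⁻ {out _ , inn _} _ (k , cr) = _ , _ , (k , UEq-refl _) , CrossU-bridge⁻ cr
  Cross-bridge⁻ {inn _ , out _} _ (k , cr) = _ , _ , (k , inj₂ (refl , refl)) , CrossU-bridge⁻ (CrossU-swapʳ cr)

  translation? : ∀ i j x y → Dec (∃[ k ] (i ≡ x + k * + p × j ≡ y - k * + q))
  translation? i j x y with + p ∣? (i - x)
  ... | no p∤i-x = no λ (k , i≡ , _) → p∤i-x (divides k (trans (cong (_- x) i≡) (x+z-x≡z x (k * + p))))
  ... | yes (divides k i-x≡kp) = map′ (λ j≡ → k , i≡ , j≡) unique (j ℤ.≟ y - k * + q)
    where
    i≡ : i ≡ x + k * + p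
    i≡ = trans (sym (x+[i-x]≡i i x)) (cong (λ z → x + z) i-x≡kp)
    unique : ∃[ k' ] (i ≡ x + k' * + p × j ≡ y - k' * + q) → j ≡ y - k * + q
    unique (k' , i≡' , j≡') =
      subst (λ l → j ≡ y - l * + q)
            (ℤ.*-cancelʳ-≡ k' k (+ p) (∙-cancelˡ x _ _ (trans (sym i≡') i≡))) j≡'

  SameArc-bridge? : ∀ i j c → IsBridging c → Dec (SameArc (bridge i j) c)
  SameArc-bridge? i j (out x , inn y) _ = map′
    (λ (k , i≡ , j≡) → k , inj₁ (cong out i≡ , cong inn j≡))
    (λ { (k , inj₁ (refl , refl)) → k , refl , refl ; (k , inj₂ (() , _)) })
    (translation? i j x y)
  SameArc-bridge? i j (inn y , out x) _ = map′
    (λ (k , i≡ , j≡) → k , inj₂ (cong out i≡ , cong inn j≡))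
    (λ { (k , inj₂ (refl , refl)) → k , refl , refl ; (k , inj₁ (() , _)) })
    (translation? i j x y)

  third-vertex : ∀ {n} {e : Fin n → Chord} {I J x} → (∀ a → IsBridging (e a)) →
    (∀ a → ¬ SameArc (bridge I (J + 1ℤ)) (e a)) → (∀ a → ¬ SameArc (bridge (I + 1ℤ) J) (e a)) →
    Joined e (out I) x → Joined e (inn J) x → x ≡ out (I - 1ℤ) ⊎ x ≡ inn (J - 1ℤ)
  third-vertex {x = out _} bridging _ _ (inj₁ (a , k , ue)) _ =
    ⊥-elim (IsBridging-resp-UEq ue (IsBridging-τ k (bridging a)))
  third-vertex {x = out _} _ _ ¬right (inj₂ (inj₁ refl)) (inj₁ (a , k , ue)) =
    ⊥-elim (¬right a (k , UEq-swapˡ ue))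
  third-vertex {x = out c} _ _ _ (inj₂ (inj₂ refl)) _ = inj₁ (cong out (sym (i+1-1≡i c)))
  third-vertex {x = inn _} bridging _ _ _ (inj₁ (a , k , ue)) =
    ⊥-elim (IsBridging-resp-UEq ue (IsBridging-τ k (bridging a)))
  third-vertex {x = inn _} _ ¬above _ (inj₁ (a , k , ue)) (inj₂ (inj₁ refl)) =
    ⊥-elim (¬above a (k , ue))
  third-vertex {x = inn c} _ _ _ _ (inj₂ (inj₂ refl)) = inj₂ (cong inn (sym (i+1-1≡i c)))

  module BridgingTriangulation {n : ℕ} (d : Fin n → Chord) (T : IsBridgingTriangulation d) where

    open IsTriangulation (proj₁ T)
    open import Data.List.Membership.DecPropositional (Fin._≟_ {n}) using (_∈?_)
    open import Data.List.Relation.Binary.Permutation.Setoid.Properties (setoid (Fin n)) using (Unique-resp-↭)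

    bridging : ∀ a → IsBridging (d a)
    bridging = proj₂ T

    lifts-nonCrossing : ∀ {a b i j i' j'} → SameArc (bridge i j) (d a) → SameArc (bridge i' j') (d b) →
                        i < i' → j < j' → ⊥
    lifts-nonCrossing {a} {b} la lb i<i' j<j' = noCross a b (CrossU⇒Cross (CrossU-bridge⁺ i<i' j<j') la lb)

    lifts : MaximalNonCrossing
    lifts = record
      { Has         = λ i j → ∃[ a ] SameArc (bridge i j) (d a)
      ; has?        = λ i j → Fin.any? λ a → SameArc-bridge? i j (d a) (bridging a)
      ; nonCrossing = λ (_ , la) (_ , lb) → lifts-nonCrossing la lb
      ; maximal     = λ free → maximal _ (inj₁ tt) λ a cr →
          let X , Y , l , c = Cross-bridge⁻ (bridging a) cr in free (a , l) c
      }

    slope-injective : ∀ {a b i j i' j'} → SameArc (bridge i j) (d a) → SameArc (bridge i' j') (d b) →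
                      i - j ≡ i' - j' → i ≡ i' × a ≡ b
    slope-injective {a} {b} {i} {j} {i'} {j'} la lb e with ℤ.<-cmp i i'
    ... | tri< i<i' _ _ = ⊥-elim (lifts-nonCrossing la lb i<i' (<-from-equal-differences e i<i'))
    ... | tri> _ _ i'<i = ⊥-elim (lifts-nonCrossing lb la i'<i (<-from-equal-differences (sym e) i'<i))
    ... | tri≈ _ refl _ with a Fin.≟ b
    ...   | yes a≡b = refl , a≡b
    ...   | no a≢b = ⊥-elim (distinct a b a≢b (SameArc-trans (SameArc-sym la) lb'))
      where
      lb' : SameArc (bridge i j) (d b)
      lb' = subst (λ y → SameArc (bridge i y) (d b))
                  (sym (ℤ.neg-injective (∙-cancelˡ i (- j) (- j') e))) lb

    arrow-around-out : ∀ {a b i j} → SameArc (bridge i j) (d a) → SameArc (bridge i (j - 1ℤ)) (d b) →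
                       Quiver d a b
    arrow-around-out {i = i} {j} (k , l) (k' , l') =
      out i , inn j , inn (j - 1ℤ) , k , k' , l , l' ,
      inj₂ (inj₂ (sym (i-1+1≡i j))) , inj₁ (oi , ii (i-1<i j))

    arrow-around-inn : ∀ {a b i j} → SameArc (bridge (i + 1ℤ) j) (d a) → SameArc (bridge i j) (d b) →
                       Quiver d a b
    arrow-around-inn {i = i} {j} (k , l) (k' , l') =
      inn j , out (i + 1ℤ) , out i , k , k' , UEq-swapˡ l , UEq-swapˡ l' ,
      inj₂ (inj₂ refl) , inj₂ (inj₁ (oo (i<i+1 i) , oi))

    pending : List (Fin n) → Fin n → Bool
    pending rest a = does (a ∈? rest)

    pending-here : ∀ i is → pending (i ∷ is) i ≡ true
    pending-here i is = dec-true (i ∈? (i ∷ is)) (here refl)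

    pending-there : ∀ {i} is {b} → b ≢ i → pending (i ∷ is) b ≡ pending is b
    pending-there {i} _ {b} b≢i with b Fin.≟ i
    ... | yes b≡i = ⊥-elim (b≢i b≡i)
    ... | no _ = refl

    -- status true: not yet flipped, the arc is where it was in T; false: flipped, hence shifted
    place : Bool → Chord → Chord
    place true  c = c
    place false c = shift c

    offset : Bool → ℤ
    offset true  = 0ℤ
    offset false = 1ℤ

    ShiftedExcept : List (Fin n) → (Fin n → Chord) → Set
    ShiftedExcept rest e = ∀ a → SameArc (e a) (place (pending rest a) (d a))

    place-lift : ∀ s {c x y} → SameArc (bridge x y) (place s c) →
                 SameArc (bridge (x + offset s) (y + offset s)) c
    place-lift true {c} l =
      subst₂ (λ x y → SameArc (bridge x y) c) (sym (ℤ.+-identityʳ _)) (sym (ℤ.+-identityʳ _)) l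
    place-lift false {c} {x} {y} l =
      SameArc-unshift (subst₂ (λ x y → SameArc (bridge x y) (shift c))
                              (sym (i+1-1≡i x)) (sym (i+1-1≡i y)) l)

    module Configuration {rest : List (Fin n)} {e : Fin n → Chord} (shifted : ShiftedExcept rest e) where

      current-bridging : ∀ a → IsBridging (e a)
      current-bridging a = IsBridging-resp-SameArc (shifted a) (place-bridging (pending rest a))
        where
        place-bridging : ∀ s → IsBridging (place s (d a))
        place-bridging true  = bridging a
        place-bridging false = IsBridging-shift (bridging a)

      original-lift : ∀ {a x y} → SameArc (bridge x y) (e a) →
        SameArc (bridge (x + offset (pending rest a)) (y + offset (pending rest a))) (d a)
      original-lift {a} l = place-lift (pending rest a) (SameArc-trans l (shifted a))

      current-lift : ∀ {a c} → SameArc c (place (pending rest a) (d a)) → SameArc c (e a)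
      current-lift {a} l = SameArc-trans l (SameArc-sym (shifted a))

      -- the shift moves both endpoints by -1 and so preserves the slope
      current-slope-injective : ∀ {a b x y x' y'} →
        SameArc (bridge x y) (e a) → SameArc (bridge x' y') (e b) → x - y ≡ x' - y' → x ≡ x'
      current-slope-injective {a} {x = x} {y} {x'} {y'} la lb slopes
        with slope-injective (original-lift la) (original-lift lb) (begin
          (x + δ) - (y + δ)     ≡⟨ common-offset x y δ ⟩
          x - y                 ≡⟨ slopes ⟩
          x' - y'               ≡⟨ common-offset x' y' δ' ⟨
          (x' + δ') - (y' + δ') ∎)
        where
        open ≡-Reasoning
        δ = offset (pending rest a)
        δ' = offset (pending rest _)
        common-offset : ∀ x y δ → (x + δ) - (y + δ) ≡ x - y
        common-offset = solve-∀
      ... | x+δ≡x'+δ , refl = ∙-cancelʳ _ x x' x+δ≡x'+δ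

    orient : Bool → Quiv n → Quiv n
    orient false Q x y = Q x y
    orient true  Q x y = Q y x

    orient-not : ∀ b {Q x y} → orient (not b) Q x y → orient b Q y x
    orient-not false q = q
    orient-not true  q = q

    reorient : (Fin n → Bool) → Quiv n → Quiv n
    reorient s Q x y = orient (s x xor s y) Q x y

    σ-reorient : ∀ {s s' i Q} → s' i ≡ not (s i) → (∀ {b} → b ≢ i → s' b ≡ s b) →
                 reorient s (Quiver d) ⇒ Q → reorient s' (Quiver d) ⇒ σ i Q
    σ-reorient {s} {s'} {i} s'i s'b oriented {x} {y} with x Fin.≟ i | y Fin.≟ i
    ... | yes refl | yes refl = λ r → oriented (subst (λ b → orient b _ i i) (begin
      s' i xor s' i  ≡⟨ xor-same (s' i) ⟩
      false          ≡⟨ xor-same (s i) ⟨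
      s i xor s i    ∎) r)
      where open ≡-Reasoning
    ... | yes refl | no y≢i = λ r → oriented (orient-not (s y xor s i) (subst (λ b → orient b _ i y) (begin
      s' i xor s' y      ≡⟨ cong₂ _xor_ s'i (s'b y≢i) ⟩
      not (s i) xor s y  ≡⟨ not-distribˡ-xor (s i) (s y) ⟨
      not (s i xor s y)  ≡⟨ cong not (xor-comm (s i) (s y)) ⟩
      not (s y xor s i)  ∎) r))
      where open ≡-Reasoning
    ... | no x≢i | yes refl = λ r → oriented (orient-not (s i xor s x) (subst (λ b → orient b _ x i) (begin
      s' x xor s' i      ≡⟨ cong₂ _xor_ (s'b x≢i) s'i ⟩
      s x xor not (s i)  ≡⟨ not-distribʳ-xor (s x) (s i) ⟨
      not (s x xor s i)  ≡⟨ cong not (xor-comm (s x) (s i)) ⟩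
      not (s i xor s x)  ∎) r))
      where open ≡-Reasoning
    ... | no x≢i | no y≢i =
      λ r → oriented (subst (λ b → orient b _ x y) (cong₂ _xor_ (s'b x≢i) (s'b y≢i)) r)

    module AtSource {i : Fin n} {is : List (Fin n)} (i∉is : i ∉ is) {e : Fin n → Chord} {Q : Quiv n}
                    (shifted : ShiftedExcept (i ∷ is) e)
                    (oriented : reorient (pending (i ∷ is)) (Quiver d) ⇒ Q)
                    (source : IsSource Q i) where

      open Configuration {i ∷ is} shifted

      no-arrow-into-source : ∀ {b} → ¬ orient (pending (i ∷ is) b xor true) (Quiver d) b i
      no-arrow-into-source {b} q =
        source b (oriented (subst (λ t → orient (pending (i ∷ is) b xor t) _ b i)
                                  (sym (pending-here i is)) q))

      arrow-from-source : ∀ {b} → Quiver d i b → pending (i ∷ is) b ≡ true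
      arrow-from-source {b} q with pending (i ∷ is) b | no-arrow-into-source {b}
      ... | true  | _  = refl
      ... | false | ¬q = ⊥-elim (¬q q)

      arrow-into-source : ∀ {b} → Quiver d b i → pending (i ∷ is) b ≡ false
      arrow-into-source {b} q with pending (i ∷ is) b | no-arrow-into-source {b}
      ... | false | _  = refl
      ... | true  | ¬q = ⊥-elim (¬q q)

      pending-current : ∀ {b c} → pending (i ∷ is) b ≡ true → SameArc c (d b) → SameArc c (e b)
      pending-current {b} {c} pb l = current-lift (subst (λ s → SameArc c (place s (d b))) (sym pb) l)

      pending-original : ∀ {b c} → pending (i ∷ is) b ≡ true → SameArc c (e b) → SameArc c (d b)
      pending-original {b} {c} pb l = subst (λ s → SameArc c (place s (d b))) pb (SameArc-trans l (shifted b))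

      done-current : ∀ {b x y} → pending (i ∷ is) b ≡ false → SameArc (bridge x y) (d b) →
                     SameArc (bridge (x - 1ℤ) (y - 1ℤ)) (e b)
      done-current {b} pb l = current-lift (subst (λ s → SameArc _ (place s (d b))) (sym pb) (SameArc-shift l))

      module _ {I J : ℤ} (li : SameArc (bridge I J) (d i)) where

        left-neighbour : ∃[ b ] SameArc (bridge (I - 1ℤ) J) (e b)
        left-neighbour with previous lifts (i , li)
        ... | inj₁ (b , lb) = b , pending-current (arrow-from-source (arrow-around-inn li' lb)) lb
          where
          li' : SameArc (bridge (I - 1ℤ + 1ℤ) J) (d i)
          li' = subst (λ x → SameArc (bridge x J) (d i)) (sym (i-1+1≡i I)) li
        ... | inj₂ (b , lb) =
          b , subst (λ y → SameArc (bridge (I - 1ℤ) y) (e b)) (i+1-1≡i J)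
                (done-current (arrow-into-source (arrow-around-out lb li')) lb)
          where
          li' : SameArc (bridge I (J + 1ℤ - 1ℤ)) (d i)
          li' = subst (λ y → SameArc (bridge I y) (d i)) (sym (i+1-1≡i J)) li

        right-neighbour : ∃[ c ] SameArc (bridge I (J - 1ℤ)) (e c)
        right-neighbour with next lifts (i , li)
        ... | inj₁ (c , lc) =
          c , subst (λ x → SameArc (bridge x (J - 1ℤ)) (e c)) (i+1-1≡i I)
                (done-current (arrow-into-source (arrow-around-inn lc li)) lc)
        ... | inj₂ (c , lc) = c , pending-current (arrow-from-source (arrow-around-out li lc)) lc

        no-lift-above : ∀ b → ¬ SameArc (bridge I (J + 1ℤ)) (e b)
        no-lift-above b l =
          ℤ.<⇒≢ (i-1<i I) (sym (current-slope-injective l (proj₂ left-neighbour) (slopes I J)))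
          where
          slopes : ∀ I J → I - (J + 1ℤ) ≡ I - 1ℤ - J
          slopes = solve-∀

        no-lift-right : ∀ b → ¬ SameArc (bridge (I + 1ℤ) J) (e b)
        no-lift-right b l =
          ℤ.<⇒≢ (i<i+1 I) (sym (current-slope-injective l (proj₂ right-neighbour) (slopes I J)))
          where
          slopes : ∀ I J → I + 1ℤ - J ≡ I - (J - 1ℤ)
          slopes = solve-∀

      i-done : pending is i ≡ false
      i-done = dec-false (i ∈? is) i∉is

      others-unchanged : ∀ {b} → b ≢ i → SameArc (e b) (place (pending is b) (d b))
      others-unchanged {b} b≢i =
        subst (λ s → SameArc (e b) (place s (d b))) (pending-there is b≢i) (shifted b)

      flip-exists : IsFlip e i (λ b → place (pending is b) (d b))
      flip-exists with bridging-lift (bridging i)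
      ... | I , J , li with pending-current (pending-here i is) li | left-neighbour li | right-neighbour li
      ...   | k , l | b , k' , lb | c , lc =
        (λ b b≢i → SameArc-sym (others-unchanged b≢i)) ,
        out I , inn J , out (I - 1ℤ) , inn (J - 1ℤ) , k , l , (λ ()) ,
        inj₂ (inj₂ (sym (i-1+1≡i I))) , inj₁ (b , k' , UEq-swapˡ lb) ,
        inj₁ (c , lc) , inj₂ (inj₂ (sym (i-1+1≡i J))) ,
        subst (λ s → SameArc (place s (d i)) (bridge (I - 1ℤ) (J - 1ℤ))) (sym i-done)
              (SameArc-sym (SameArc-shift li))

      corners : ∀ {X Y u w} → SameArc (bridge X Y) (d i) →
                (u ≡ out X × w ≡ inn Y ⊎ u ≡ inn Y × w ≡ out X) →
                ∀ {z} → Joined e u z → Joined e w z → z ≡ out (X - 1ℤ) ⊎ z ≡ inn (Y - 1ℤ)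
      corners li (inj₁ (refl , refl)) uz wz =
        third-vertex current-bridging (no-lift-above li) (no-lift-right li) uz wz
      corners li (inj₂ (refl , refl)) uz wz =
        third-vertex current-bridging (no-lift-above li) (no-lift-right li) wz uz

      flip-result : ∀ {u w x y k c} → UEq (u , w) (τ k (e i)) → x ≢ y →
                    Joined e u x → Joined e w x → Joined e u y → Joined e w y →
                    SameArc c (x , y) → SameArc c (shift (d i))
      flip-result uw x≢y ux wx uy wy new
        with X , Y , l , ends ← bridging-endpoints (current-bridging i) uw
        with li ← pending-original (pending-here i is) l
        with corners li ends ux wx | corners li ends uy wy
      ... | inj₁ refl | inj₁ refl = ⊥-elim (x≢y refl)
      ... | inj₂ refl | inj₂ refl = ⊥-elim (x≢y refl)
      ... | inj₁ refl | inj₂ refl = SameArc-trans new (SameArc-shift li)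
      ... | inj₂ refl | inj₁ refl =
        SameArc-trans (SameArc-swapʳ {a = inn (Y - 1ℤ)} {out (X - 1ℤ)} new) (SameArc-shift li)

      flip-shifts : ∀ {e'} → IsFlip e i e' → ShiftedExcept is e'
      flip-shifts (unchanged , _ , _ , _ , _ , _ , uw , x≢y , ux , wx , uy , wy , new) b with b Fin.≟ i
      ... | no b≢i   = SameArc-trans (unchanged b b≢i) (others-unchanged b≢i)
      ... | yes refl =
        subst (λ s → SameArc _ (place s (d i))) (sym i-done) (flip-result uw x≢y ux wx uy wy new)

    Outcome : List (Fin n) → (Fin n → Chord) → Set
    Outcome rest e = (∃[ e' ] CoxChain e rest e') × (∀ e' → CoxChain e rest e' → ShiftedExcept [] e')

    flip-sequence : ∀ {rest Q e} → Unique rest → reorient (pending rest) (Quiver d) ⇒ Q →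
                    AdmissibleSeq Q rest → ShiftedExcept rest e → Outcome rest e
    flip-sequence {[]} _ _ _ shifted = (_ , done) , λ { _ done → shifted }
    flip-sequence {i ∷ is} (i∉is ∷ unique) oriented (source , admissible) shifted =
      (_ , step flip-exists (proj₂ (proj₁ (continue λ _ → SameArc-refl _)))) ,
      λ { _ (step flip chain) → proj₂ (continue (flip-shifts flip)) _ chain }
      where
      open AtSource (All¬⇒¬Any i∉is) shifted oriented source
      continue : ∀ {e'} → ShiftedExcept is e' → Outcome is e'
      continue = flip-sequence unique (σ-reorient i-flips others-kept oriented) admissible
        where
        i-flips : pending is i ≡ not (pending (i ∷ is) i)
        i-flips = trans i-done (cong not (sym (pending-here i is)))
        others-kept : ∀ {b} → b ≢ i → pending is b ≡ pending (i ∷ is) b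
        others-kept b≢i = sym (pending-there is b≢i)

    coxeter-shifts : ∀ {ord} → ord ↭ allFin n → AdmissibleSeq (Quiver d) ord → Outcome ord d
    coxeter-shifts {ord} ord↭ admissible = flip-sequence unique oriented admissible shifted
      where
      all-pending : ∀ a → pending ord a ≡ true
      all-pending a = dec-true (a ∈? ord) (∈-resp-↭ (↭-sym ord↭) (∈-allFin a))
      unique : Unique ord
      unique = Unique-resp-↭ (↭⇒↭ₛ (↭-sym ord↭)) (allFin⁺ n)
      oriented : reorient (pending ord) (Quiver d) ⇒ Quiver d
      oriented {x} {y} = subst (λ s → orient s _ x y) (cong₂ _xor_ (all-pending x) (all-pending y))
      shifted : ShiftedExcept ord d
      shifted a = subst (λ s → SameArc (d a) (place s (d a))) (sym (all-pending a)) (SameArc-refl (d a))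

open import Data.Nat using (_<_; _≤_)

mainTheorem2 : (p q : ℕ) → 0 < p → 0 < q → q ≤ p →
    (n : ℕ) (d : Fin n → Chord) → Annulus.IsBridgingTriangulation p q d →
    (ord : List (Fin n)) → ord ↭ allFin n →
    AdmissibleSeq (Annulus.Quiver p q d) ord →
    (∃[ d' ] Annulus.CoxChain p q d ord d') ×
    (∀ d' → Annulus.CoxChain p q d ord d' →
      ∀ a → Annulus.SameArc p q (d' a) (shift (d a)))
mainTheorem2 p q 0<p _ _ n d T ord ord↭allFin admissible =
  Cover.BridgingTriangulation.coxeter-shifts p q {{>-nonZero 0<p}} d T ord↭allFin admissible
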